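{- For every integer $n\geq 1$, $$c_{2n}+1=8(2b_n+1)B_n.$$
   Context: The balancing numbers $B_k$ ($k\ge 0$) are defined by $B_0=0$, $B_1=1$, $B_{k+1}=6B_k-B_{k-1}$ for $k\ge1$. The cobalancing numbers $b_k$ ($k\ge1$) are defined by $b_1=0$, $b_2=2$, $b_{k+1}=6b_k-b_{k-1}+2$ for $k\ge2$. The Lucas-cobalancing numbers $c_k$ ($k\ge1$) are defined by $c_1=1$, $c_2=7$, $c_{k+1}=6c_k-c_{k-1}$ for $k\ge2$. -}

module Defs where

open import Data.Nat using (ℕ; zero; suc)
open import Data.Integer using (ℤ; +_; _+_; _-_; _*_)

B : ℕ → ℤ
B zero = + 0
B (suc zero) = + 1
B (suc (suc k)) = + 6 * B (suc k) - B k

-- Cobalancing numbers, shifted: cobal' k = b_(k+1)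
-- b_1 = 0, b_2 = 2, b_(k+1) = 6 b_k - b_(k-1) + 2
cobal' : ℕ → ℤ
cobal' zero = + 0
cobal' (suc zero) = + 2
cobal' (suc (suc k)) = + 6 * cobal' (suc k) - cobal' k + + 2

-- b k for k ≥ 1; b 0 is an arbitrary junk value (never used)
b : ℕ → ℤ
b zero = + 0
b (suc k) = cobal' k

-- Lucas-cobalancing numbers, shifted: lc' k = c_(k+1)
-- c_1 = 1, c_2 = 7, c_(k+1) = 6 c_k - c_(k-1)
lc' : ℕ → ℤ
lc' zero = + 1
lc' (suc zero) = + 7
lc' (suc (suc k)) = + 6 * lc' (suc k) - lc' k

-- c k for k ≥ 1; c 0 is an arbitrary junk value (never used)
c : ℕ → ℤ
c zero = + 0
c (suc k) = lc' k

module Submission where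

-- Every sequence in sight obeys the linear recurrence s_{k+2} = 6 s_{k+1} - s_k,
-- and two solutions of it agreeing at 0 and 1 agree everywhere.  This gives
--   * 2 b_{m+1} + 1 = B_{m+1} - B_m          (cobalancing via balancing),
--   * c_{k+1}       = B_{k+1} + B_k          (Lucas-cobalancing via balancing),
--   * B_{k+m+1}     = B_{m+1} B_{k+1} - B_m B_k   (addition formula).
-- Independently, B_{m+1}² - 6 B_{m+1} B_m + B_m² = 1 (Cassini-type invariant).
-- For n = m + 1 write x = B_{m+1}, y = B_m.  Then c_{2n} = B_{2m+2} + B_{2m+1}
-- expands by the addition formula into a quadratic form in x and y; replacing
-- the summand 1 by the Cassini form x² - 6xy + y² turns the left side into
-- 8 (x - y) x, and x - y = 2 b_n + 1.

open import Defs
open import Data.Nat using (ℕ; _≤_; _*_; zero; suc)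
open import Data.Integer using (ℤ; +_; _+_; _-_)
import Data.Integer as ℤ
import Data.Nat as ℕ
open import Data.Nat.Properties using (+-suc; +-identityʳ)
open import Relation.Binary.PropositionalEquality
  using (_≡_; refl; sym; trans; cong; cong₂; module ≡-Reasoning)
open import Data.Integer.Tactic.RingSolver using (solve-∀)

-- The balancing recurrence s_{k+2} = 6 s_{k+1} - s_k (a record, so that the
-- sequence can be recovered from a proof that it is recurrent).
record Recurrent (s : ℕ → ℤ) : Set where
  constructor recurrent
  field step : ∀ k → s (suc (suc k)) ≡ + 6 ℤ.* s (suc k) - s k
open Recurrent

recurrent-unique : ∀ {f g : ℕ → ℤ} → Recurrent f → Recurrent g →
                   f 0 ≡ g 0 → f 1 ≡ g 1 → ∀ k → f k ≡ g k
recurrent-unique rf rg e₀ e₁ zero = e₀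
recurrent-unique rf rg e₀ e₁ (suc zero) = e₁
recurrent-unique {f} {g} rf rg e₀ e₁ (suc (suc k)) = begin
  f (suc (suc k))              ≡⟨ step rf k ⟩
  + 6 ℤ.* f (suc k) - f k      ≡⟨ cong₂ (λ u v → + 6 ℤ.* u - v)
                                        (recurrent-unique rf rg e₀ e₁ (suc k))
                                        (recurrent-unique rf rg e₀ e₁ k) ⟩
  + 6 ℤ.* g (suc k) - g k      ≡⟨ sym (step rg k) ⟩
  g (suc (suc k))              ∎
  where open ≡-Reasoning

offset-recurrent : ∀ {s} d → Recurrent s → Recurrent (λ k → s (k ℕ.+ d))
offset-recurrent d rs = recurrent λ k → step rs (k ℕ.+ d)

combination-recurrent : ∀ {s} (α β : ℤ) → Recurrent s →
                        Recurrent (λ k → α ℤ.* s (suc k) + β ℤ.* s k)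
combination-recurrent {s} α β rs = recurrent λ k → begin
  α ℤ.* s (suc (suc (suc k))) + β ℤ.* s (suc (suc k))
    ≡⟨ cong₂ (λ u v → α ℤ.* u + β ℤ.* v) (step rs (suc k)) (step rs k) ⟩
  α ℤ.* (+ 6 ℤ.* s (suc (suc k)) - s (suc k)) + β ℤ.* (+ 6 ℤ.* s (suc k) - s k)
    ≡⟨ regroup α β (s (suc (suc k))) (s (suc k)) (s k) ⟩
  + 6 ℤ.* (α ℤ.* s (suc (suc k)) + β ℤ.* s (suc k)) - (α ℤ.* s (suc k) + β ℤ.* s k) ∎
  where
  open ≡-Reasoning
  regroup : ∀ α β u v w → α ℤ.* (+ 6 ℤ.* u - v) + β ℤ.* (+ 6 ℤ.* v - w)
                        ≡ + 6 ℤ.* (α ℤ.* u + β ℤ.* v) - (α ℤ.* v + β ℤ.* w)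
  regroup = solve-∀

B-recurrent : Recurrent B
B-recurrent = recurrent λ k → refl

lc'-recurrent : Recurrent lc'
lc'-recurrent = recurrent λ k → refl

-- The odd numbers 2 b + 1 satisfy the homogeneous recurrence, since the
-- inhomogeneity + 2 of the cobalancing recurrence is absorbed by the + 1.
odd-cobal'-recurrent : Recurrent (λ k → + 2 ℤ.* cobal' k + + 1)
odd-cobal'-recurrent = recurrent λ k → absorb (cobal' (suc k)) (cobal' k)
  where
  absorb : ∀ u v → + 2 ℤ.* (+ 6 ℤ.* u - v + + 2) + + 1
                 ≡ + 6 ℤ.* (+ 2 ℤ.* u + + 1) - (+ 2 ℤ.* v + + 1)
  absorb = solve-∀

cobal'-via-B : ∀ m → + 2 ℤ.* cobal' m + + 1 ≡ B (suc m) - B m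
cobal'-via-B m = trans (recurrent-unique odd-cobal'-recurrent
  (combination-recurrent (+ 1) (ℤ.- + 1) B-recurrent) refl refl m) (unit (B (suc m)) (B m))
  where
  unit : ∀ u v → + 1 ℤ.* u + ℤ.- + 1 ℤ.* v ≡ u - v
  unit = solve-∀

lc'-via-B : ∀ k → lc' k ≡ B (suc k) + B k
lc'-via-B k = trans (recurrent-unique lc'-recurrent
  (combination-recurrent (+ 1) (+ 1) B-recurrent) refl refl k) (unit (B (suc k)) (B k))
  where
  unit : ∀ u v → + 1 ℤ.* u + + 1 ℤ.* v ≡ u + v
  unit = solve-∀

-- Addition formula: B_{k+m+1} = B_{m+1} B_{k+1} - B_m B_k.  For fixed m both
-- sides solve the recurrence in k (the left one is a shift of B).
B-addition : ∀ k m → B (suc (k ℕ.+ m)) ≡ B (suc m) ℤ.* B (suc k) - B m ℤ.* B k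
B-addition k m = trans
  (recurrent-unique (offset-recurrent {λ j → B (suc j)} m (recurrent λ j → refl))
    (combination-recurrent (B (suc m)) (ℤ.- B m) B-recurrent)
    (initial₀ (B (suc m)) (B m)) (initial₁ (B (suc m)) (B m)) k)
  (negate (B (suc m)) (B (suc k)) (B m) (B k))
  where
  initial₀ : ∀ x y → x ≡ x ℤ.* + 1 + ℤ.- y ℤ.* + 0
  initial₀ = solve-∀
  initial₁ : ∀ x y → + 6 ℤ.* x - y ≡ x ℤ.* + 6 + ℤ.- y ℤ.* + 1
  initial₁ = solve-∀
  negate : ∀ x u y v → x ℤ.* u + ℤ.- y ℤ.* v ≡ x ℤ.* u - y ℤ.* v
  negate = solve-∀

cassiniForm : ℤ → ℤ → ℤ
cassiniForm x y = x ℤ.* x - + 6 ℤ.* x ℤ.* y + y ℤ.* y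

cassiniForm-step : ∀ x y → cassiniForm (+ 6 ℤ.* x - y) x ≡ cassiniForm x y
cassiniForm-step = expanded
  where
  expanded : ∀ x y → (+ 6 ℤ.* x - y) ℤ.* (+ 6 ℤ.* x - y) - + 6 ℤ.* (+ 6 ℤ.* x - y) ℤ.* x + x ℤ.* x
                   ≡ x ℤ.* x - + 6 ℤ.* x ℤ.* y + y ℤ.* y
  expanded = solve-∀

B-cassini : ∀ m → cassiniForm (B (suc m)) (B m) ≡ + 1
B-cassini zero = refl
B-cassini (suc m) = trans (cassiniForm-step (B (suc m)) (B m)) (B-cassini m)

-- The algebraic core: with P = B_{2m+2} and Q = B_{2m+1} expanded by the
-- addition formula, P + Q + (x² - 6xy + y²) factors as 8 (x - y) x.
doubling-factorisation : ∀ x y →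
  (x ℤ.* (+ 6 ℤ.* x - y) - y ℤ.* x) + (x ℤ.* x - y ℤ.* y) + cassiniForm x y
    ≡ + 8 ℤ.* (x - y) ℤ.* x
doubling-factorisation = expanded
  where
  expanded : ∀ x y → (x ℤ.* (+ 6 ℤ.* x - y) - y ℤ.* x) + (x ℤ.* x - y ℤ.* y)
                       + (x ℤ.* x - + 6 ℤ.* x ℤ.* y + y ℤ.* y)
                   ≡ + 8 ℤ.* (x - y) ℤ.* x
  expanded = solve-∀

-- 2 (m + 1) = (m + 1) + m + 1, the index shape required by the addition formula.
double-suc : ∀ m → 2 * suc m ≡ suc (suc m ℕ.+ m)
double-suc m = cong suc (trans (cong (m ℕ.+_) (cong suc (+-identityʳ m))) (+-suc m m))

mainTheorem9 : (n : ℕ) → 1 ≤ n → c (2 * n) + + 1 ≡ (+ 8 Data.Integer.* (+ 2 Data.Integer.* b n + + 1)) Data.Integer.* B n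
mainTheorem9 (suc m) _ = begin
  c (2 * suc m) + + 1                           ≡⟨ cong (λ j → c j + + 1) (double-suc m) ⟩
  lc' (suc m ℕ.+ m) + + 1                       ≡⟨ cong (_+ + 1) (lc'-via-B (suc m ℕ.+ m)) ⟩
  B (suc (suc m ℕ.+ m)) + B (suc (m ℕ.+ m)) + + 1
    ≡⟨ cong₂ (λ p q → p + q + + 1) (B-addition (suc m) m) (B-addition m m) ⟩
  (x ℤ.* (+ 6 ℤ.* x - y) - y ℤ.* x) + (x ℤ.* x - y ℤ.* y) + + 1
    ≡⟨ cong (λ t → (x ℤ.* (+ 6 ℤ.* x - y) - y ℤ.* x) + (x ℤ.* x - y ℤ.* y) + t) (sym (B-cassini m)) ⟩
  (x ℤ.* (+ 6 ℤ.* x - y) - y ℤ.* x) + (x ℤ.* x - y ℤ.* y) + cassiniForm x y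
    ≡⟨ doubling-factorisation x y ⟩
  + 8 ℤ.* (x - y) ℤ.* x                         ≡⟨ cong (λ t → + 8 ℤ.* t ℤ.* x) (sym (cobal'-via-B m)) ⟩
  + 8 ℤ.* (+ 2 ℤ.* b (suc m) + + 1) ℤ.* B (suc m) ∎
  where
  open ≡-Reasoning
  x y : ℤ
  x = B (suc m)
  y = B m
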